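{- Let $R=([n],\triangleright)$ be a rack and let $1\leqslant\Delta\leqslant n-1$. Then $(S_{>\Delta}(R),\triangleright)$ and $(S_{\leqslant\Delta}(R),\triangleright)$ are both subracks of $R$.
   Context: Maps are written on the right; $(x)f_y = x\triangleright y$, each $f_y$ a permutation of $[n]$ with $f_{(y)f_z}=f_z^{ -1}f_yf_z$. A subset $Y\subseteq[n]$ forms a subrack iff $(z)f_y\in Y$ for all $y,z\in Y$. $d_R^+(v) = |\{(v)f_j : j\in[n],\ (v)f_j\neq v\}|$. $S_{\leqslant\Delta}(R)=\{v\in[n]: d_R^+(v)\leqslant\Delta\}$ and $S_{>\Delta}(R)=[n]\setminus S_{\leqslant\Delta}(R)$. -}

module Defs where

open import Data.Nat using (ℕ; _≤_)
open import Data.Fin using (Fin; _≟_)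
open import Data.Fin.Subset using (Subset; ∣_∣; _∈_)
open import Data.Fin.Properties using (any?)
open import Data.Vec using (tabulate)
open import Data.Bool using (Bool; true; false; _∧_; not)
open import Data.Product using (_×_; Σ; ∃)
open import Relation.Nullary using (¬_; Dec)
open import Relation.Nullary.Decidable using (⌊_⌋)
open import Relation.Binary.PropositionalEquality using (_≡_)
open import Function.Bundles using (Inverse; _↔_)

-- A rack on [n] = Fin n.  x ▷ y = (x)f_y, maps written on the right.
record Rack (n : ℕ) : Set where
  field
    _▷_ : Fin n → Fin n → Fin n
    perm : (y : Fin n) → Fin n ↔ Fin n
    perm-is-f : (y x : Fin n) → Inverse.to (perm y) x ≡ x ▷ y
    -- f_{(y)f_z} = f_z⁻¹ f_y f_z  (composition left-to-right):
    -- x f_{y▷z} = ((x f_z⁻¹) f_y) f_z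
    rack-law : (x y z : Fin n) →
      x ▷ (y ▷ z) ≡ ((Inverse.from (perm z) x) ▷ y) ▷ z

module _ {n : ℕ} (R : Rack n) where
  open Rack R

  outNbrs : Fin n → Subset n
  outNbrs v = tabulate λ w →
    not ⌊ w ≟ v ⌋ ∧ ⌊ any? (λ j → v ▷ j ≟ w) ⌋

  outdeg : Fin n → ℕ
  outdeg v = ∣ outNbrs v ∣

  SLe : ℕ → Fin n → Set
  SLe Δ v = outdeg v ≤ Δ

  SGt : ℕ → Fin n → Set
  SGt Δ v = ¬ (outdeg v ≤ Δ)

  IsSubrack : (Fin n → Set) → Set
  IsSubrack Y = (y z : Fin n) → Y y → Y z → Y (z ▷ y)

-- Every right translation f_y = (_▷ y) is a rack automorphism (right self-distributivity),
-- so it maps the out-neighbours of z bijectively onto those of z ▷ y and therefore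
-- d⁺(z ▷ y) = d⁺(z).  Any set of elements cut out by a condition on the out-degree
-- is thus closed under ▷; S_{>Δ} and S_{≤Δ} are two such sets.
module Submission where

open import Defs
open import Data.Nat using (ℕ; _≤_; _∸_; zero; suc)
open import Data.Nat.Properties using (+-0-commutativeMonoid)
open import Data.Bool using (Bool; true; false; _∧_; not)
open import Data.Fin using (Fin; zero; suc; _≟_)
open import Data.Fin.Subset using (∣_∣)
open import Data.Fin.Properties using (any?)
open import Data.Fin.Permutation using (Permutation′)
open import Data.Vec using (tabulate)
open import Data.Vec.Properties using (tabulate-cong)
open import Data.Product using (_×_; _,_; ∃-syntax)
open import Function using (_∘_)
open import Function.Bundles using (Inverse; _⇔_; mk⇔)
open import Relation.Nullary using (¬_; Dec)
open import Relation.Nullary.Decidable using (⌊_⌋; isYes≗does; does-⇔)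
open import Relation.Binary.PropositionalEquality
open import Algebra.Properties.CommutativeMonoid.Sum +-0-commutativeMonoid
  using (sum; sum-cong-≗; sum-permute)

fromBool : Bool → ℕ
fromBool true  = 1
fromBool false = 0

∣tabulate∣≡sum : ∀ {n} (g : Fin n → Bool) → ∣ tabulate g ∣ ≡ sum (fromBool ∘ g)
∣tabulate∣≡sum {zero}  g = refl
∣tabulate∣≡sum {suc n} g with g zero
... | true  = cong suc (∣tabulate∣≡sum (g ∘ suc))
... | false = ∣tabulate∣≡sum (g ∘ suc)

∣tabulate∣-permute : ∀ {n} (g : Fin n → Bool) (σ : Permutation′ n) →
                     ∣ tabulate (g ∘ Inverse.to σ) ∣ ≡ ∣ tabulate g ∣
∣tabulate∣-permute g σ = begin
  ∣ tabulate (g ∘ Inverse.to σ) ∣  ≡⟨ ∣tabulate∣≡sum (g ∘ Inverse.to σ) ⟩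
  sum (fromBool ∘ g ∘ Inverse.to σ) ≡⟨ sum-permute (fromBool ∘ g) σ ⟨
  sum (fromBool ∘ g)                ≡⟨ ∣tabulate∣≡sum g ⟨
  ∣ tabulate g ∣                    ∎
  where open ≡-Reasoning

⌊⌋-⇔ : ∀ {a b} {A : Set a} {B : Set b} → A ⇔ B →
       (a? : Dec A) (b? : Dec B) → ⌊ a? ⌋ ≡ ⌊ b? ⌋
⌊⌋-⇔ A⇔B a? b? = trans (isYes≗does a?) (trans (does-⇔ A⇔B a? b?) (sym (isYes≗does b?)))

module _ {n : ℕ} (R : Rack n) where
  open Rack R

  ▷-from : ∀ y x → Inverse.from (perm y) x ▷ y ≡ x
  ▷-from y x = trans (sym (perm-is-f y _)) (Inverse.inverseˡ (perm y) refl)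

  from-▷ : ∀ y x → Inverse.from (perm y) (x ▷ y) ≡ x
  from-▷ y x = trans (cong (Inverse.from (perm y)) (sym (perm-is-f y x)))
                     (Inverse.inverseʳ (perm y) refl)

  ▷-cancelʳ : ∀ y {a b} → a ▷ y ≡ b ▷ y → a ≡ b
  ▷-cancelʳ y {a} {b} e = begin
    a                             ≡⟨ from-▷ y a ⟨
    Inverse.from (perm y) (a ▷ y) ≡⟨ cong (Inverse.from (perm y)) e ⟩
    Inverse.from (perm y) (b ▷ y) ≡⟨ from-▷ y b ⟩
    b                             ∎
    where open ≡-Reasoning

  ▷-distribʳ : ∀ a y z → (a ▷ z) ▷ (y ▷ z) ≡ (a ▷ y) ▷ z
  ▷-distribʳ a y z = trans (rack-law (a ▷ z) y z) (cong (λ t → (t ▷ y) ▷ z) (from-▷ z a))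

  isOutNbr : Fin n → Fin n → Bool
  isOutNbr v w = not ⌊ w ≟ v ⌋ ∧ ⌊ any? (λ j → v ▷ j ≟ w) ⌋

  reaches-▷ : ∀ z y w → (∃[ j ] (z ▷ y) ▷ j ≡ w ▷ y) ⇔ (∃[ j ] z ▷ j ≡ w)
  reaches-▷ z y w = mk⇔
    (λ (j , e) → Inverse.from (perm y) j , ▷-cancelʳ y (begin
      (z ▷ Inverse.from (perm y) j) ▷ y       ≡⟨ ▷-distribʳ z _ y ⟨
      (z ▷ y) ▷ (Inverse.from (perm y) j ▷ y) ≡⟨ cong ((z ▷ y) ▷_) (▷-from y j) ⟩
      (z ▷ y) ▷ j                             ≡⟨ e ⟩
      w ▷ y                                   ∎))
    (λ (j , e) → j ▷ y , trans (▷-distribʳ z j y) (cong (_▷ y) e))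
    where open ≡-Reasoning

  isOutNbr-▷ : ∀ z y w → isOutNbr (z ▷ y) (w ▷ y) ≡ isOutNbr z w
  isOutNbr-▷ z y w = cong₂ (λ p q → not p ∧ q)
    (⌊⌋-⇔ (mk⇔ (▷-cancelʳ y) (cong (_▷ y))) (w ▷ y ≟ z ▷ y) (w ≟ z))
    (⌊⌋-⇔ (reaches-▷ z y w) (any? _) (any? _))

  outdeg-▷ : ∀ z y → outdeg R (z ▷ y) ≡ outdeg R z
  outdeg-▷ z y = begin
    ∣ tabulate (isOutNbr (z ▷ y)) ∣                       ≡⟨ ∣tabulate∣-permute _ (perm y) ⟨
    ∣ tabulate (isOutNbr (z ▷ y) ∘ Inverse.to (perm y)) ∣ ≡⟨ cong ∣_∣ (tabulate-cong translated) ⟩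
    ∣ tabulate (isOutNbr z) ∣                             ∎
    where
    open ≡-Reasoning
    translated : ∀ w → isOutNbr (z ▷ y) (Inverse.to (perm y) w) ≡ isOutNbr z w
    translated w = trans (cong (isOutNbr (z ▷ y)) (perm-is-f y w)) (isOutNbr-▷ z y w)

  outdeg-subrack : (P : ℕ → Set) → IsSubrack R (P ∘ outdeg R)
  outdeg-subrack P y z _ Pz = subst P (sym (outdeg-▷ z y)) Pz

lemma4p7 : (n : ℕ) (R : Rack n) (Δ : ℕ) → 1 ≤ Δ → Δ ≤ n ∸ 1 →
    IsSubrack R (SGt R Δ) × IsSubrack R (SLe R Δ)
lemma4p7 n R Δ _ _ = outdeg-subrack R (λ d → ¬ d ≤ Δ) , outdeg-subrack R (_≤ Δ)
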